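{- For $n\ge1$ define $p(n,k)$, $q(n,k)$ by $x(x+2)\cdots(x+2n-2)=\sum_{k=1}^np(n,k)x^k$ and $(x+1)(x+3)\cdots(x+2n-1)=\sum_{k=0}^nq(n,k)x^k$; set $p(0,0)=q(0,0)=1$, and $p(m,k)=0$ whenever $k\notin\{1,\dots,m\}$ for $m\ge1$, $p(0,k)=0$ for $k\ne0$. Then for all $n\ge0$ and $0\le k\le n$, $$q(n,k)=\sum_{m=k}^n\binom{n}{m}(2n-2m-1)!!\,p(m,k).$$
   Context: Double factorials: $(2m-1)!!=1\cdot3\cdots(2m-1)$, with $(-1)!!=1$. -}

module Defs where

open import Data.Nat using (ℕ; zero; suc; _+_; _*_; _∸_)
open import Data.List using (List; []; _∷_)
open import Data.Nat.Combinatorics using (_C_)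

-- Polynomials with natural-number coefficients as coefficient lists,
-- lowest degree first:  a₀ ∷ a₁ ∷ … represents a₀ + a₁ x + …
Poly : Set
Poly = List ℕ

coeff : Poly → ℕ → ℕ
coeff []       _       = 0
coeff (a ∷ _)  zero    = a
coeff (_ ∷ as) (suc k) = coeff as k

-- multiply a polynomial by (x + c)
mulLin : ℕ → Poly → Poly
mulLin c []       = []
mulLin c (a ∷ as) = c * a ∷ addX a (mulLin c as)
  where
  addX : ℕ → Poly → Poly
  addX a []       = a ∷ []
  addX a (b ∷ bs) = a + b ∷ bs

pPoly : ℕ → Poly
pPoly zero    = 1 ∷ []
pPoly (suc n) = mulLin (2 * n) (pPoly n)

qPoly : ℕ → Poly
qPoly zero    = 1 ∷ []
qPoly (suc n) = mulLin (suc (2 * n)) (qPoly n)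

p : ℕ → ℕ → ℕ
p n k = coeff (pPoly n) k

q : ℕ → ℕ → ℕ
q n k = coeff (qPoly n) k

-- oddDF j = (2j-1)!! = 1·3⋯(2j-1), with oddDF 0 = (-1)!! = 1
oddDF : ℕ → ℕ
oddDF zero    = 1
oddDF (suc j) = suc (2 * j) * oddDF j

-- Σ_{m=k}^{n} f m   (0 if k > n)
sumFromTo : ℕ → ℕ → (ℕ → ℕ) → ℕ
sumFromTo k zero    f = ifZero k (f 0)
  where
  ifZero : ℕ → ℕ → ℕ
  ifZero zero    x = x
  ifZero (suc _) _ = 0
sumFromTo k (suc n) f = sumFromTo k n f + inRange k (suc n) (f (suc n))
  where
  inRange : ℕ → ℕ → ℕ → ℕ
  inRange zero    _       x = x
  inRange (suc _) zero    _ = 0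
  inRange (suc k) (suc m) x = inRange k m x

module Submission where

-- Write P_m(x) = x(x+2)⋯(x+2m-2) and Q_n(x) = (x+1)(x+3)⋯(x+2n-1).
-- The theorem is the coefficient form of the polynomial identity
--     Q_n = Σ_{m=0}^{n} C(n,m) (2n-2m-1)!! P_m ,
-- proved by induction on n.  Multiplying by x+2n+1 and splitting this
-- factor as (x+2m) + (2(n-m)+1) turns the m-th summand into
--     C(n,m) (2n-2m-1)!! P_{m+1} + C(n,m) (2n-2m+1)!! P_m ,
-- and Pascal's rule merges the two resulting sums into the expansion
-- of Q_{n+1}.
--
-- The expansion is then proved for every k, and the theorem follows by
-- dropping the summands m < k, which vanish since deg P_m = m.

open import Defs
open import Data.Nat using (ℕ; _≤_; _*_; _∸_)
open import Data.Nat.Combinatorics using (_C_)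
open import Relation.Binary.PropositionalEquality using (_≡_)

open import Data.Nat using (zero; suc; _+_; _<_; z≤n; s≤s)
open import Data.Nat.Properties
  using (+-identityʳ; +-assoc; +-comm; *-zeroʳ; *-distribˡ-+;
         +-cancelˡ-≡; +-∸-assoc; m+[n∸m]≡n; m<n⇒m<1+n; m≤n⇒m≤1+n; n<1+n; ≤-refl)
open import Data.Nat.Combinatorics using (nCk+nC[k+1]≡[n+1]C[k+1]; k>n⇒nCk≡0)
open import Data.List using ([]; _∷_)
open import Data.Nat.Tactic.RingSolver using (solve-∀)
open import Relation.Binary.PropositionalEquality
  using (refl; sym; trans; cong; cong₂; module ≡-Reasoning)

Σ≤ : ℕ → (ℕ → ℕ) → ℕ
Σ≤ zero    f = f 0
Σ≤ (suc n) f = Σ≤ n f + f (suc n)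

Σ≤-cong : ∀ n {f g : ℕ → ℕ} → (∀ m → m ≤ n → f m ≡ g m) → Σ≤ n f ≡ Σ≤ n g
Σ≤-cong zero    f≗g = f≗g 0 z≤n
Σ≤-cong (suc n) f≗g =
  cong₂ _+_ (Σ≤-cong n (λ m m≤n → f≗g m (m≤n⇒m≤1+n m≤n))) (f≗g (suc n) ≤-refl)

Σ≤-+ : ∀ n (f g : ℕ → ℕ) → Σ≤ n (λ m → f m + g m) ≡ Σ≤ n f + Σ≤ n g
Σ≤-+ zero    f g = refl
Σ≤-+ (suc n) f g =
  trans (cong (_+ (f (suc n) + g (suc n))) (Σ≤-+ n f g))
        (interchange (Σ≤ n f) (Σ≤ n g) (f (suc n)) (g (suc n)))
  where
  interchange : ∀ a b c d → a + b + (c + d) ≡ a + c + (b + d)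
  interchange = solve-∀

Σ≤-*ˡ : ∀ n c (f : ℕ → ℕ) → Σ≤ n (λ m → c * f m) ≡ c * Σ≤ n f
Σ≤-*ˡ zero    c f = refl
Σ≤-*ˡ (suc n) c f =
  trans (cong (_+ c * f (suc n)) (Σ≤-*ˡ n c f)) (sym (*-distribˡ-+ c (Σ≤ n f) (f (suc n))))

Σ≤-head : ∀ n (f : ℕ → ℕ) → Σ≤ (suc n) f ≡ f 0 + Σ≤ n (λ m → f (suc m))
Σ≤-head zero    f = refl
Σ≤-head (suc n) f = trans (cong (_+ f (suc (suc n))) (Σ≤-head n f)) (+-assoc (f 0) _ _)

-- [k ≤ m] x : x if k ≤ m, else 0 (the guard used in the definition of sumFromTo)
guard : ℕ → ℕ → ℕ → ℕ
guard zero    _       x = x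
guard (suc _) zero    _ = 0
guard (suc k) (suc m) x = guard k m x

-- the defining recursion of sumFromTo, with its (local) guard made nameable;
-- the suc/suc case identifies the two guards by cancelling the common prefix
sumFromTo-step : ∀ k n (f : ℕ → ℕ) →
  sumFromTo k (suc n) f ≡ sumFromTo k n f + guard k (suc n) (f (suc n))
sumFromTo-step zero          n       f = refl
sumFromTo-step (suc zero)    zero    f = refl
sumFromTo-step (suc (suc k)) zero    f = refl
sumFromTo-step (suc k)       (suc n) f =
  cong (sumFromTo (suc k) (suc n) f +_)
    (+-cancelˡ-≡ (sumFromTo k n (λ _ → x)) _ _ (sumFromTo-step k n (λ _ → x)))
  where x = f (suc (suc n))

guard-below-vanishing : ∀ k m x → (m < k → x ≡ 0) → guard k m x ≡ x
guard-below-vanishing zero    m       x x≡0 = refl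
guard-below-vanishing (suc k) zero    x x≡0 = sym (x≡0 (s≤s z≤n))
guard-below-vanishing (suc k) (suc m) x x≡0 = guard-below-vanishing k m x (λ m<k → x≡0 (s≤s m<k))

sumFromTo≡Σ≤ : ∀ k n (f : ℕ → ℕ) → (∀ m → m < k → f m ≡ 0) → sumFromTo k n f ≡ Σ≤ n f
sumFromTo≡Σ≤ zero    zero    f f≡0 = refl
sumFromTo≡Σ≤ (suc k) zero    f f≡0 = sym (f≡0 0 (s≤s z≤n))
sumFromTo≡Σ≤ k       (suc n) f f≡0 =
  trans (sumFromTo-step k n f)
        (cong₂ _+_ (sumFromTo≡Σ≤ k n f f≡0)
                   (guard-below-vanishing k (suc n) (f (suc n)) (f≡0 (suc n))))

-- coefficients of (x + c)·A:  [x^k] = c·[x^k]A + [x^k](x·A),  and x·A = 0 ∷ A;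
-- the tail case inspects mulLin c as, since mulLin adds a into its head
coeff-mulLin : ∀ c as k → coeff (mulLin c as) k ≡ c * coeff as k + coeff (0 ∷ as) k
coeff-mulLin c []       zero    = sym (trans (+-identityʳ _) (*-zeroʳ c))
coeff-mulLin c []       (suc k) = sym (trans (+-identityʳ _) (*-zeroʳ c))
coeff-mulLin c (a ∷ as) zero    = sym (+-identityʳ _)
coeff-mulLin c (a ∷ as) (suc k) with mulLin c as | coeff-mulLin c as
... | []     | ih with k
...   | zero  = sym (cong (_+ a) (trans (sym (+-identityʳ _)) (sym (ih 0))))
...   | suc j = ih (suc j)
coeff-mulLin c (a ∷ as) (suc k) | b ∷ bs | ih with k
...   | zero  = trans (cong (a +_) (trans (ih 0) (+-identityʳ _))) (+-comm a _)
...   | suc j = ih (suc j)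

p-above-degree : ∀ m k → m < k → p m k ≡ 0
p-above-degree zero    (suc k) _         = refl
p-above-degree (suc m) (suc k) (s≤s m<k) =
  trans (coeff-mulLin (2 * m) (pPoly m) (suc k))
        (cong₂ _+_ (trans (cong (2 * m *_) (p-above-degree m (suc k) (m<n⇒m<1+n m<k)))
                          (*-zeroʳ (2 * m)))
                   (p-above-degree m k m<k))

pascal-convolution : ∀ (d b : ℕ → ℕ) n →
  Σ≤ n (λ m → (n C m) * d (n ∸ m) * b (suc m)) + Σ≤ n (λ m → (n C m) * d (suc n ∸ m) * b m)
    ≡ Σ≤ (suc n) (λ m → (suc n C m) * d (suc n ∸ m) * b m)
pascal-convolution d b n = begin
    Σ≤ n A + Σ≤ n G
  ≡⟨ cong (Σ≤ n A +_) G-head ⟩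
    Σ≤ n A + (G 0 + Σ≤ n (λ m → G (suc m)))
  ≡⟨ interchange (Σ≤ n A) (G 0) _ ⟩
    G 0 + (Σ≤ n A + Σ≤ n (λ m → G (suc m)))
  ≡⟨ cong (G 0 +_) (sym (Σ≤-+ n A (λ m → G (suc m)))) ⟩
    G 0 + Σ≤ n (λ m → A m + G (suc m))
  ≡⟨ cong (G 0 +_) (Σ≤-cong n (λ m _ → sym (pascal m))) ⟩
    H 0 + Σ≤ n (λ m → H (suc m))
  ≡⟨ sym (Σ≤-head n H) ⟩
    Σ≤ (suc n) H
  ∎
  where
  open ≡-Reasoning
  A G H : ℕ → ℕ
  A m = (n C m) * d (n ∸ m) * b (suc m)
  G m = (n C m) * d (suc n ∸ m) * b m
  H m = (suc n C m) * d (suc n ∸ m) * b m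

  -- the summand m = n+1 of the G-sum carries C(n,n+1) = 0
  lastG≡0 : G (suc n) ≡ 0
  lastG≡0 = cong (λ c → c * d (n ∸ n) * b (suc n)) (k>n⇒nCk≡0 (n<1+n n))

  -- extending the G-sum by its zero summand m = n+1 and splitting off m = 0
  G-head : Σ≤ n G ≡ G 0 + Σ≤ n (λ m → G (suc m))
  G-head = trans (sym (trans (cong (Σ≤ n G +_) lastG≡0) (+-identityʳ (Σ≤ n G)))) (Σ≤-head n G)

  pascal : ∀ m → H (suc m) ≡ A m + G (suc m)
  pascal m = trans (cong (λ c → c * d (n ∸ m) * b (suc m)) (sym (nCk+nC[k+1]≡[n+1]C[k+1] n m)))
                   (distrib (n C m) (n C suc m) (d (n ∸ m)) (b (suc m)))
    where
    distrib : ∀ c c′ e f → (c + c′) * e * f ≡ c * e * f + c′ * e * f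
    distrib = solve-∀

  interchange : ∀ a g s → a + (g + s) ≡ g + (a + s)
  interchange = solve-∀

expansion : ℕ → (ℕ → ℕ) → ℕ
expansion n a = Σ≤ n (λ m → (n C m) * oddDF (n ∸ m) * a m)

-- splitting x+2n+1 = (x+2m) + (2(n-m)+1) in the m-th summand (coefficient of x^k),
-- using P_{m+1} = (x+2m) P_m and (2j+1)!! = (2j+1)·(2j-1)!!
summand-split : ∀ n m k → m ≤ n →
  suc (2 * n) * ((n C m) * oddDF (n ∸ m) * p m k) + (n C m) * oddDF (n ∸ m) * coeff (0 ∷ pPoly m) k
    ≡ (n C m) * oddDF (n ∸ m) * p (suc m) k + (n C m) * oddDF (suc n ∸ m) * p m k
summand-split n m k m≤n = begin
    suc (2 * n) * (c * oddDF j * P) + c * oddDF j * xP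
  ≡⟨ cong (λ n′ → suc (2 * n′) * (c * oddDF j * P) + c * oddDF j * xP) (sym (m+[n∸m]≡n m≤n)) ⟩
    suc (2 * (m + j)) * (c * oddDF j * P) + c * oddDF j * xP
  ≡⟨ regroup m j c (oddDF j) P xP ⟩
    c * oddDF j * (2 * m * P + xP) + c * (suc (2 * j) * oddDF j) * P
  ≡⟨ cong₂ _+_ (cong (c * oddDF j *_) (sym (coeff-mulLin (2 * m) (pPoly m) k)))
               (cong (λ i → c * oddDF i * P) (sym (+-∸-assoc 1 m≤n))) ⟩
    c * oddDF j * p (suc m) k + c * oddDF (suc n ∸ m) * P
  ∎
  where
  open ≡-Reasoning
  c j P xP : ℕ
  c  = n C m
  j  = n ∸ m
  P  = p m k
  xP = coeff (0 ∷ pPoly m) k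

  regroup : ∀ m j c D P xP →
    suc (2 * (m + j)) * (c * D * P) + c * D * xP ≡ c * D * (2 * m * P + xP) + c * (suc (2 * j) * D) * P
  regroup = solve-∀

q-expansion : ∀ n k → q n k ≡ expansion n (λ m → p m k)
q-expansion zero    zero    = refl
q-expansion zero    (suc k) = refl
q-expansion (suc n) k = begin
    q (suc n) k
  ≡⟨ coeff-mulLin (suc (2 * n)) (qPoly n) k ⟩
    suc (2 * n) * q n k + coeff (0 ∷ qPoly n) k
  ≡⟨ cong₂ _+_ (cong (suc (2 * n) *_) (q-expansion n k)) (shifted k) ⟩
    suc (2 * n) * expansion n (λ m → p m k) + expansion n (λ m → coeff (0 ∷ pPoly m) k)
  ≡⟨ cong (_+ expansion n _) (sym (Σ≤-*ˡ n (suc (2 * n)) _)) ⟩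
    Σ≤ n (λ m → suc (2 * n) * ((n C m) * oddDF (n ∸ m) * p m k)) + expansion n _
  ≡⟨ sym (Σ≤-+ n _ _) ⟩
    Σ≤ n (λ m → suc (2 * n) * ((n C m) * oddDF (n ∸ m) * p m k)
                + (n C m) * oddDF (n ∸ m) * coeff (0 ∷ pPoly m) k)
  ≡⟨ Σ≤-cong n (λ m m≤n → summand-split n m k m≤n) ⟩
    Σ≤ n (λ m → (n C m) * oddDF (n ∸ m) * p (suc m) k + (n C m) * oddDF (suc n ∸ m) * p m k)
  ≡⟨ Σ≤-+ n _ _ ⟩
    Σ≤ n (λ m → (n C m) * oddDF (n ∸ m) * p (suc m) k) + Σ≤ n (λ m → (n C m) * oddDF (suc n ∸ m) * p m k)
  ≡⟨ pascal-convolution oddDF (λ m → p m k) n ⟩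
    expansion (suc n) (λ m → p m k)
  ∎
  where
  open ≡-Reasoning
  -- the same expansion for x·Q_n against x·P_m (both start with coefficient 0)
  shifted : ∀ k → coeff (0 ∷ qPoly n) k ≡ expansion n (λ m → coeff (0 ∷ pPoly m) k)
  shifted zero    = sym (trans (Σ≤-cong n (λ m _ → *-zeroʳ ((n C m) * oddDF (n ∸ m))))
                               (Σ≤-*ˡ n 0 (λ _ → 0)))
  shifted (suc k) = q-expansion n k

-- Main theorem: the summands with m < k vanish because deg P_m = m

mainTheorem10 : (n k : ℕ) → k ≤ n →
    q n k ≡ sumFromTo k n (λ m → (n C m) * oddDF (n ∸ m) * p m k)
mainTheorem10 n k _ =
  trans (q-expansion n k)
        (sym (sumFromTo≡Σ≤ k n _ (λ m m<k →
               trans (cong ((n C m) * oddDF (n ∸ m) *_) (p-above-degree m k m<k))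
                     (*-zeroʳ ((n C m) * oddDF (n ∸ m))))))
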